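{- Let $(\mathbf{C},\mathcal{M})$ satisfy the standing assumptions of the context. Let $a:B\to A$ and $b:B\to C$ be $\mathcal{M}$-morphisms and $c:A\to C$ a morphism with $c\circ a=b$. Let $c=m\circ e$ be the epi-$\mathcal{M}$-factorization of $c$ ($e:A\to E$ epi, $m:E\to C$ in $\mathcal{M}$), let $E\xleftarrow{d}D\xrightarrow{m'}B$ be the pullback of $E\xrightarrow{m}C\xleftarrow{b}B$, and let $e':B\to D$ be the morphism induced by $e\circ a$ and $id_B$. Then $B\cong D$.
   Context: Standing assumptions: $(\mathbf{C},\mathcal{M})$ is $\mathcal{M}$-adhesive with $\mathcal{M}$ a class of monomorphisms (contains isos; closed under composition and decomposition; pushouts/pullbacks along $\mathcal{M}$-morphisms exist and $\mathcal{M}$ is stable under them; pushouts along $\mathcal{M}$-morphisms are $\mathcal{M}$-van Kampen squares); $\mathbf{C}$ has epi-$\mathcal{M}$-factorizations (every morphism factors as an epimorphism followed by an $\mathcal{M}$-morphism, uniquely up to isomorphism), is balanced, has a strict $\mathcal{M}$-initial object, and has $\mathcal{M}$-effective unions (if $\mathcal{M}$-morphisms $B\leftarrow A\to C$ have pushout $D$ and $\mathcal{M}$-morphisms $B\to E\leftarrow C$ form with them a pullback square, the induced $D\to E$ is in $\mathcal{M}$). -}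

module Defs where

open import Level using (Level; _⊔_; suc)
open import Data.Product using (Σ; _×_; _,_; ∃-syntax; Σ-syntax)
open import Relation.Binary using (IsEquivalence)

record Category (o ℓ e : Level) : Set (suc (o ⊔ ℓ ⊔ e)) where
  infixr 9 _∘_
  infix  4 _≈_
  field
    Obj       : Set o
    _⇒_       : Obj → Obj → Set ℓ
    _≈_       : ∀ {A B} → A ⇒ B → A ⇒ B → Set e
    id        : ∀ {A} → A ⇒ A
    _∘_       : ∀ {A B C} → B ⇒ C → A ⇒ B → A ⇒ C
    assoc     : ∀ {A B C D} {f : A ⇒ B} {g : B ⇒ C} {h : C ⇒ D} →
                (h ∘ g) ∘ f ≈ h ∘ (g ∘ f)
    identityˡ : ∀ {A B} {f : A ⇒ B} → id ∘ f ≈ f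
    identityʳ : ∀ {A B} {f : A ⇒ B} → f ∘ id ≈ f
    equiv     : ∀ {A B} → IsEquivalence (_≈_ {A} {B})
    ∘-resp-≈  : ∀ {A B C} {f h : B ⇒ C} {g i : A ⇒ B} →
                f ≈ h → g ≈ i → f ∘ g ≈ h ∘ i

module _ {o ℓ e : Level} (𝒞 : Category o ℓ e) where
  open Category 𝒞

  Mono : ∀ {A B} → A ⇒ B → Set (o ⊔ ℓ ⊔ e)
  Mono {A} f = ∀ {X} (g h : X ⇒ A) → f ∘ g ≈ f ∘ h → g ≈ h

  Epi : ∀ {A B} → A ⇒ B → Set (o ⊔ ℓ ⊔ e)
  Epi {B = B} f = ∀ {X} (g h : B ⇒ X) → g ∘ f ≈ h ∘ f → g ≈ h

  IsIso : ∀ {A B} → A ⇒ B → Set (ℓ ⊔ e)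
  IsIso {A} {B} f = Σ[ g ∈ B ⇒ A ] (g ∘ f ≈ id × f ∘ g ≈ id)

  _≅_ : Obj → Obj → Set (ℓ ⊔ e)
  A ≅ B = Σ[ f ∈ A ⇒ B ] IsIso f

  IsInitial : Obj → Set (o ⊔ ℓ ⊔ e)
  IsInitial I = ∀ A → Σ[ u ∈ I ⇒ A ] (∀ (v : I ⇒ A) → v ≈ u)

  record IsPullback {P A B C : Obj} (f : A ⇒ C) (g : B ⇒ C)
                    (p₁ : P ⇒ A) (p₂ : P ⇒ B) : Set (o ⊔ ℓ ⊔ e) where
    field
      commute   : f ∘ p₁ ≈ g ∘ p₂
      universal : ∀ {X} (h₁ : X ⇒ A) (h₂ : X ⇒ B) → f ∘ h₁ ≈ g ∘ h₂ →
                  Σ[ u ∈ X ⇒ P ] (p₁ ∘ u ≈ h₁ × p₂ ∘ u ≈ h₂)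
      unique    : ∀ {X} (u v : X ⇒ P) → p₁ ∘ u ≈ p₁ ∘ v → p₂ ∘ u ≈ p₂ ∘ v →
                  u ≈ v

  record IsPushout {A B C D : Obj} (f : A ⇒ B) (g : A ⇒ C)
                   (i₁ : B ⇒ D) (i₂ : C ⇒ D) : Set (o ⊔ ℓ ⊔ e) where
    field
      commute   : i₁ ∘ f ≈ i₂ ∘ g
      universal : ∀ {X} (h₁ : B ⇒ X) (h₂ : C ⇒ X) → h₁ ∘ f ≈ h₂ ∘ g →
                  Σ[ u ∈ D ⇒ X ] (u ∘ i₁ ≈ h₁ × u ∘ i₂ ≈ h₂)
      unique    : ∀ {X} (u v : D ⇒ X) → u ∘ i₁ ≈ v ∘ i₁ → u ∘ i₂ ≈ v ∘ i₂ →
                  u ≈ v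

module _ {o ℓ e : Level} (𝒞 : Category o ℓ e) where
  open Category 𝒞

  MorClass : (p : Level) → Set (o ⊔ ℓ ⊔ suc p)
  MorClass p = ∀ {A B} → A ⇒ B → Set p

  module _ {p : Level} (ℳ : MorClass p) where

    -- ℳ-van Kampen square: the pushout  A --f--> B, A --m--> C,
    -- B --n--> D, C --g--> D  (bottom face, n ∘ f ≈ g ∘ m) is ℳ-VK if for
    -- every commutative cube over it with vertical morphisms b, c, d ∈ ℳ
    -- whose back faces are pullbacks, the top face is a pushout iff both
    -- front faces are pullbacks.
    IsℳVanKampen : ∀ {A B C D} (f : A ⇒ B) (m : A ⇒ C)
                   (n : B ⇒ D) (g : C ⇒ D) → Set (o ⊔ ℓ ⊔ e ⊔ p)
    IsℳVanKampen {A} {B} {C} {D} f m n g =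
      ∀ {A' B' C' D'}
        (f' : A' ⇒ B') (m' : A' ⇒ C') (n' : B' ⇒ D') (g' : C' ⇒ D')
        (a : A' ⇒ A) (b : B' ⇒ B) (c : C' ⇒ C) (d : D' ⇒ D) →
        -- the cube commutes
        n' ∘ f' ≈ g' ∘ m' →           -- top face
        f ∘ a ≈ b ∘ f' →              -- back faces
        m ∘ a ≈ c ∘ m' →
        n ∘ b ≈ d ∘ n' →              -- front faces
        g ∘ c ≈ d ∘ g' →
        ℳ b → ℳ c → ℳ d →
        IsPullback 𝒞 f b a f' →
        IsPullback 𝒞 m c a m' →
        (IsPushout 𝒞 f' m' n' g' →
           IsPullback 𝒞 n d b n' × IsPullback 𝒞 g d c g')
        × (IsPullback 𝒞 n d b n' → IsPullback 𝒞 g d c g' →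
           IsPushout 𝒞 f' m' n' g')

    record StandingAssumptions : Set (o ⊔ ℓ ⊔ e ⊔ p) where
      field
        ℳ⇒mono         : ∀ {A B} (f : A ⇒ B) → ℳ f → Mono 𝒞 f
        iso⇒ℳ          : ∀ {A B} (f : A ⇒ B) → IsIso 𝒞 f → ℳ f
        ℳ-comp         : ∀ {A B C} (f : A ⇒ B) (g : B ⇒ C) →
                         ℳ f → ℳ g → ℳ (g ∘ f)
        ℳ-decomp       : ∀ {A B C} (f : A ⇒ B) (g : B ⇒ C) →
                         ℳ (g ∘ f) → ℳ g → ℳ f
        pushout-along-ℳ : ∀ {A B C} (f : A ⇒ B) (m : A ⇒ C) → ℳ m →
                         Σ[ D ∈ Obj ] Σ[ i₁ ∈ B ⇒ D ] Σ[ i₂ ∈ C ⇒ D ]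
                           IsPushout 𝒞 f m i₁ i₂
        pullback-along-ℳ : ∀ {A B C} (f : A ⇒ C) (m : B ⇒ C) → ℳ m →
                         Σ[ P ∈ Obj ] Σ[ p₁ ∈ P ⇒ A ] Σ[ p₂ ∈ P ⇒ B ]
                           IsPullback 𝒞 f m p₁ p₂
        ℳ-pushout-stable : ∀ {A B C D} (f : A ⇒ B) (m : A ⇒ C)
                         (i₁ : B ⇒ D) (i₂ : C ⇒ D) →
                         IsPushout 𝒞 f m i₁ i₂ → ℳ m → ℳ i₁
        ℳ-pullback-stable : ∀ {P A B C} (f : A ⇒ C) (m : B ⇒ C)
                         (p₁ : P ⇒ A) (p₂ : P ⇒ B) →
                         IsPullback 𝒞 f m p₁ p₂ → ℳ m → ℳ p₁
        pushout-along-ℳ-VK : ∀ {A B C D} (f : A ⇒ B) (m : A ⇒ C)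
                         (n : B ⇒ D) (g : C ⇒ D) → ℳ m →
                         IsPushout 𝒞 f m n g → IsℳVanKampen f m n g
        factorize      : ∀ {A B} (f : A ⇒ B) →
                         Σ[ E ∈ Obj ] Σ[ ε ∈ A ⇒ E ] Σ[ μ ∈ E ⇒ B ]
                           (Epi 𝒞 ε × ℳ μ × μ ∘ ε ≈ f)
        factorize-unique : ∀ {A B E E'} (f : A ⇒ B)
                         (ε : A ⇒ E) (μ : E ⇒ B) (ε' : A ⇒ E') (μ' : E' ⇒ B) →
                         Epi 𝒞 ε → ℳ μ → μ ∘ ε ≈ f →
                         Epi 𝒞 ε' → ℳ μ' → μ' ∘ ε' ≈ f →
                         Σ[ i ∈ E ⇒ E' ] (IsIso 𝒞 i × i ∘ ε ≈ ε' × μ' ∘ i ≈ μ)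
        balanced       : ∀ {A B} (f : A ⇒ B) → Mono 𝒞 f → Epi 𝒞 f → IsIso 𝒞 f
        I              : Obj
        I-initial      : IsInitial 𝒞 I
        I-ℳ            : ∀ A (u : I ⇒ A) → ℳ u
        I-strict       : ∀ {A} (f : A ⇒ I) → IsIso 𝒞 f
        ℳ-effective-unions :
          ∀ {A B C D E} (f : A ⇒ B) (g : A ⇒ C) (i₁ : B ⇒ D) (i₂ : C ⇒ D)
            (h : B ⇒ E) (k : C ⇒ E) →
          ℳ f → ℳ g → IsPushout 𝒞 f g i₁ i₂ →
          ℳ h → ℳ k → IsPullback 𝒞 h k f g →
          (u : D ⇒ E) → u ∘ i₁ ≈ h → u ∘ i₂ ≈ k → ℳ u

-- The projection m' has e' as a section, and e' ∘ m' agrees with the identity on both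
-- pullback legs: trivially on m', and on d because m is mono and
-- m ∘ d ≈ b ∘ m' ≈ m ∘ e ∘ a ∘ m' forces d ≈ e ∘ a ∘ m'.
module Submission where

open import Defs
open import Level using (Level)
open import Data.Product using (_,_)
open import Relation.Binary.Bundles using (Setoid)
import Relation.Binary.Reasoning.Setoid as SetoidReasoning

module _ {o ℓ e : Level} (𝒞 : Category o ℓ e) where
  open Category 𝒞

  hom-setoid : Obj → Obj → Setoid ℓ e
  hom-setoid X Y = record { Carrier = X ⇒ Y ; _≈_ = _≈_ ; isEquivalence = equiv }

  module HomReasoning {X Y : Obj} where
    open Setoid (hom-setoid X Y) public using (refl)
    open SetoidReasoning (hom-setoid X Y) public

  pullback-section-iso : ∀ {P A B C} {f : A ⇒ C} {g : B ⇒ C} {p₁ : P ⇒ A} {p₂ : P ⇒ B} →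
                         IsPullback 𝒞 f g p₁ p₂ →
                         (s : B ⇒ P) → p₂ ∘ s ≈ id → p₁ ∘ (s ∘ p₂) ≈ p₁ →
                         _≅_ 𝒞 B P
  pullback-section-iso {p₁ = p₁} {p₂} pb s p₂s≈id p₁sp₂≈p₁ =
    s , p₂ , p₂s≈id , unique (s ∘ p₂) id p₁-agrees p₂-agrees
    where
    open IsPullback pb
    open HomReasoning

    p₁-agrees : p₁ ∘ (s ∘ p₂) ≈ p₁ ∘ id
    p₁-agrees = begin
      p₁ ∘ (s ∘ p₂) ≈⟨ p₁sp₂≈p₁ ⟩
      p₁            ≈⟨ identityʳ ⟨
      p₁ ∘ id       ∎

    p₂-agrees : p₂ ∘ (s ∘ p₂) ≈ p₂ ∘ id
    p₂-agrees = begin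
      p₂ ∘ (s ∘ p₂) ≈⟨ assoc ⟨
      (p₂ ∘ s) ∘ p₂ ≈⟨ ∘-resp-≈ p₂s≈id refl ⟩
      id ∘ p₂       ≈⟨ identityˡ ⟩
      p₂            ≈⟨ identityʳ ⟨
      p₂ ∘ id       ∎

lemmaA2 : ∀ {o ℓ e p : Level} (𝒞 : Category o ℓ e) (ℳ : MorClass 𝒞 p) →
          StandingAssumptions 𝒞 ℳ →
          let open Category 𝒞 in
          ∀ {A B C E D : Obj}
            (a : B ⇒ A) (b : B ⇒ C) (c : A ⇒ C) →
            ℳ a → ℳ b → c ∘ a ≈ b →
            (e : A ⇒ E) (m : E ⇒ C) → Epi 𝒞 e → ℳ m → m ∘ e ≈ c →
            (d : D ⇒ E) (m' : D ⇒ B) → IsPullback 𝒞 m b d m' →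
            (e' : B ⇒ D) → d ∘ e' ≈ e ∘ a → m' ∘ e' ≈ id →
            _≅_ 𝒞 B D
lemmaA2 𝒞 ℳ SA a b c _ _ ca≈b e m _ m∈ℳ me≈c d m' pb e' de'≈ea m'e'≈id =
  pullback-section-iso 𝒞 pb e' m'e'≈id de'm'≈d
  where
  open Category 𝒞
  open StandingAssumptions SA using (ℳ⇒mono)
  open IsPullback pb using (commute)
  open HomReasoning 𝒞

  eam'≈d : e ∘ (a ∘ m') ≈ d
  eam'≈d = ℳ⇒mono m m∈ℳ (e ∘ (a ∘ m')) d (begin
    m ∘ (e ∘ (a ∘ m')) ≈⟨ assoc ⟨
    (m ∘ e) ∘ (a ∘ m') ≈⟨ ∘-resp-≈ me≈c refl ⟩
    c ∘ (a ∘ m')       ≈⟨ assoc ⟨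
    (c ∘ a) ∘ m'       ≈⟨ ∘-resp-≈ ca≈b refl ⟩
    b ∘ m'             ≈⟨ commute ⟨
    m ∘ d              ∎)

  de'm'≈d : d ∘ (e' ∘ m') ≈ d
  de'm'≈d = begin
    d ∘ (e' ∘ m')  ≈⟨ assoc ⟨
    (d ∘ e') ∘ m'  ≈⟨ ∘-resp-≈ de'≈ea refl ⟩
    (e ∘ a) ∘ m'   ≈⟨ assoc ⟩
    e ∘ (a ∘ m')   ≈⟨ eam'≈d ⟩
    d              ∎
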